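{- Let $q$ be a prime, $F=\mathbb{Z}/q\mathbb{Z}$, $F^*=F\setminus\{0\}$, and let $A\subset F^*$ with $|A|>1$. Let $$H:=\Big\{s\in F:\ |\{(a,b):a,b\in A,\ s=a/b\}|\ge \frac{|A|^2}{5|A\cdot A|}\Big\},$$ and let $G$ be the subgroup of the multiplicative group $F^*$ generated by $H$. Then there exists $\xi\in G$ such that $$\min\left(\frac{|A|^3}{5|A\cdot A|},\ \frac{|A|^2|G|}{|A|^2+|G|}\right)\le |S_\xi(A)|<|A|^2.$$
   Context: $A\cdot A:=\{ab:a,b\in A\}$; for $\xi\in F$, $S_\xi(A):=\{a+b\xi:a,b\in A\}$. -}

module Defs where

open import Data.Nat using (ℕ; zero; suc; _+_; _*_; _≤_; _≤?_; NonZero; _%_)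
open import Data.Nat.DivMod using (m%n<n)
open import Data.Fin using (Fin; toℕ; fromℕ<)
open import Data.Fin.Properties using (any?) renaming (_≟_ to _≟F_)
open import Data.Fin.Subset using (Subset; _∈_; ∣_∣)
open import Data.Fin.Subset.Properties using (_∈?_)
open import Data.Vec using (tabulate)
open import Data.List using (List; length; filter; cartesianProduct; allFin)
open import Data.Product using (_×_; _,_; ∃; ∃-syntax)
open import Relation.Nullary using (¬_; does)
open import Relation.Nullary.Decidable using (_×-dec_)
open import Relation.Binary.PropositionalEquality using (_≡_)

module _ {q : ℕ} .{{_ : NonZero q}} where

  -- arithmetic of F = ℤ/qℤ, elements represented by Fin q (residues 0..q-1)
  _·F_ : Fin q → Fin q → Fin q
  a ·F b = fromℕ< (m%n<n (toℕ a * toℕ b) q)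

  _+F_ : Fin q → Fin q → Fin q
  a +F b = fromℕ< (m%n<n (toℕ a + toℕ b) q)

  oneF : Fin q
  oneF = fromℕ< (m%n<n 1 q)

  prodSet : Subset q → Subset q
  prodSet A = tabulate λ s →
    does (any? λ a → any? λ b → (a ∈? A) ×-dec ((b ∈? A) ×-dec ((a ·F b) ≟F s)))

  S : Fin q → Subset q → Subset q
  S ξ A = tabulate λ s →
    does (any? λ a → any? λ b → (a ∈? A) ×-dec ((b ∈? A) ×-dec ((a +F (b ·F ξ)) ≟F s)))

  -- number of pairs (a,b) ∈ A×A with s = a/b, i.e. s·b = a (b ≠ 0 as A ⊆ F*)
  ratioCount : Subset q → Fin q → ℕ
  ratioCount A s = length (filter
    (λ p → (Data.Product.proj₁ p ∈? A) ×-dec ((Data.Product.proj₂ p ∈? A)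
             ×-dec ((s ·F Data.Product.proj₂ p) ≟F Data.Product.proj₁ p)))
    (cartesianProduct (allFin q) (allFin q)))

  -- s ∈ H  iff  ratioCount ≥ |A|²/(5|A·A|), cross-multiplied
  InH : Subset q → Fin q → Set
  InH A s = ∣ A ∣ * ∣ A ∣ ≤ 5 * ∣ prodSet A ∣ * ratioCount A s

  -- the subgroup of F* generated by H (H ∖ {0}; in fact 0 ∉ H)
  data Gen (A : Subset q) : Fin q → Set where
    gen-base : ∀ {s} → ¬ (toℕ s ≡ 0) → InH A s → Gen A s
    gen-one  : Gen A oneF
    gen-mul  : ∀ {x y} → Gen A x → Gen A y → Gen A (x ·F y)
    gen-inv  : ∀ {x y} → Gen A x → (x ·F y) ≡ oneF → Gen A y

-- Call ξ deficient when |S_ξ(A)| < |A|², i.e. when (a, b) ↦ a + bξ is not injective on A × A;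
-- ξ = 1 is deficient because a + b = b + a for two distinct a, b ∈ A.
--
-- If deficiency is not constant on G = ⟨H⟩, some x ∈ G and h ∈ H (so h ≠ 0) have exactly one of
-- x, xh deficient; call the deficient one ξ and the other η. On the |A|·r(h) pairs (a, d) ∈ A² with
-- hd ∈ A, where r(h) = #{(c, d) ∈ A² : c = hd}, the map (a, d) ↦ a + hd·ξ = a + d·η (if η = ξh),
-- resp. (a, d) ↦ a + d·ξ = a + hd·η (if ξ = ηh), is injective because η is not deficient and h ≠ 0.
-- Its image lies in S_ξ(A), so |S_ξ(A)| ≥ |A|·r(h) ≥ |A|³/(5|A·A|) since h ∈ H.
--
-- Otherwise every ξ ∈ G is deficient. With r_ξ(s) = #{(a, b) ∈ A² : a + bξ = s} and E(ξ) = Σ_s r_ξ(s)²,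
-- Cauchy–Schwarz gives |A|⁴ ≤ |S_ξ(A)|·E(ξ). Two distinct lines ξ ↦ a + bξ meet at most once, so
-- Σ_{ξ∈G} E(ξ) ≤ |A|²(|G| + |A|²), and a ξ ∈ G whose energy is at most the average satisfies
-- |S_ξ(A)| ≥ |A|²|G|/(|A|² + |G|).

module Submission where

open import Data.Bool using (true; false; if_then_else_)
open import Data.Empty using (⊥-elim)
open import Data.Fin using (Fin; zero; suc; toℕ)
open import Data.Fin.Properties as Fin using (_≟_; any?; toℕ-injective; toℕ<n; toℕ-fromℕ<)
open import Data.Fin.Subset using (Subset; _∈_; _⊆_; ∣_∣; ⁅_⁆; inside; outside)
open import Data.Fin.Subset.Properties
  using (_∈?_; nonempty?; Empty-unique; ∣⊥∣≡0; p⊆q⇒∣p∣≤∣q∣; ∣⁅x⁆∣≡1; x∈⁅x⁆)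
open import Data.List using (List; length; filter; cartesianProduct; allFin; map; _++_)
import Data.List as List
open import Data.List.Properties using (length-++; filter-++; map-tabulate)
open import Data.Nat as ℕ
  using (ℕ; zero; suc; _+_; _*_; _∸_; _^_; _≤_; _<_; _⊓_; _%_; _/_; z≤n; s≤s; z<s; _≤?_; _<?_; NonZero; >-nonZero)
open import Data.Nat.DivMod
open import Data.Nat.Divisibility using (_∣_; divides; n∣m⇒m%n≡0)
open import Data.Nat.Primality using (Prime; euclidsLemma)
open import Data.Nat.Properties hiding (_≟_)
open import Data.Nat.Tactic.RingSolver using (solve-∀)
open import Algebra.Properties.CommutativeSemigroup *-commutativeSemigroup using (x∙yz≈y∙xz; x∙yz≈yx∙z; xy∙z≈x∙zy)
open import Algebra.Properties.Semiring.Sum +-*-semiring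
  using (sum; sum-syntax; sum-cong-≗; ∑-comm; ∑-distrib-+; *-distribˡ-sum; *-distribʳ-sum; sum-replicate-zero)
open import Data.Product using (_×_; _,_; ∃; ∃-syntax; proj₁; proj₂)
open import Data.Sum using (_⊎_; inj₁; inj₂)
open import Data.Vec using ([]; _∷_; tabulate)
open import Data.Vec.Properties using (lookup⇒[]=; lookup∘tabulate)
open import Function using (_∘_; id; _⇔_; Equivalence; mk⇔)
open import Function.Properties.Equivalence using () renaming (refl to ⇔-refl; sym to ⇔-sym; trans to ⇔-trans)
open import Relation.Binary.Bundles using (Setoid)
open import Relation.Binary.Construct.On as On using ()
open import Relation.Binary.PropositionalEquality
import Relation.Binary.Reasoning.Setoid
open import Relation.Nullary using (¬_; Dec; yes; no; does)
open import Relation.Nullary.Decidable using (_×-dec_; _⊎-dec_; dec-true; ¬?; decidable-stable)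
open import Relation.Unary using (Pred; Decidable)

open import Defs

-- Indicators and finite sums

χ : ∀ {p} {P : Set p} → Dec P → ℕ
χ P? = if does P? then 1 else 0

χ≤1 : ∀ {p} {P : Set p} (P? : Dec P) → χ P? ≤ 1
χ≤1 (yes _) = s≤s z≤n
χ≤1 (no _)  = z≤n

χ-yes : ∀ {p} {P : Set p} (P? : Dec P) → P → χ P? ≡ 1
χ-yes (yes _) _ = refl
χ-yes (no ¬p) p = ⊥-elim (¬p p)

χ-no : ∀ {p} {P : Set p} (P? : Dec P) → ¬ P → χ P? ≡ 0
χ-no (yes p) ¬p = ⊥-elim (¬p p)
χ-no (no _)  _  = refl

0<χ⇒ : ∀ {p} {P : Set p} (P? : Dec P) → 0 < χ P? → P
0<χ⇒ (yes p) _ = p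

χ-×-dec : ∀ {p r} {P : Set p} {R : Set r} (P? : Dec P) (R? : Dec R) → χ (P? ×-dec R?) ≡ χ P? * χ R?
χ-×-dec (yes _) (yes _) = refl
χ-×-dec (yes _) (no _)  = refl
χ-×-dec (no _)  _       = refl

0<χ*χ⇒ : ∀ {p r} {P : Set p} {R : Set r} (P? : Dec P) (R? : Dec R) → 0 < χ P? * χ R? → P × R
0<χ*χ⇒ P? R? 0<χχ = 0<χ⇒ (P? ×-dec R?) (subst (0 <_) (sym (χ-×-dec P? R?)) 0<χχ)

≤χ : ∀ {p} {P : Set p} (P? : Dec P) {x} → x ≤ 1 → (0 < x → P) → x ≤ χ P?
≤χ (yes _) x≤1 _   = x≤1
≤χ (no ¬p) _   0<x⇒p = ≮⇒≥ (¬p ∘ 0<x⇒p)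

sum-zero : ∀ {n} {f : Fin n → ℕ} → (∀ i → f i ≡ 0) → sum f ≡ 0
sum-zero {n} f≗0 = trans (sum-cong-≗ f≗0) (sum-replicate-zero n)

sum-mono-≤ : ∀ {n} {f g : Fin n → ℕ} → (∀ i → f i ≤ g i) → sum f ≤ sum g
sum-mono-≤ {zero}  f≤g = z≤n
sum-mono-≤ {suc n} f≤g = +-mono-≤ (f≤g zero) (sum-mono-≤ (f≤g ∘ suc))

sum-mono-< : ∀ {n} {f g : Fin n → ℕ} → (∀ i → f i ≤ g i) → ∀ k → f k < g k → sum f < sum g
sum-mono-< f≤g zero    fk<gk = +-mono-<-≤ fk<gk (sum-mono-≤ (f≤g ∘ suc))
sum-mono-< f≤g (suc k) fk<gk = +-mono-≤-< (f≤g zero) (sum-mono-< (f≤g ∘ suc) k fk<gk)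

term≤sum : ∀ {n} (f : Fin n → ℕ) i → f i ≤ sum f
term≤sum f zero    = m≤m+n _ _
term≤sum f (suc i) = ≤-trans (term≤sum (f ∘ suc) i) (m≤n+m _ _)

two-terms≤sum : ∀ {n} (f : Fin n → ℕ) {i j} → i ≢ j → f i + f j ≤ sum f
two-terms≤sum f {zero}  {zero}  0≢0 = ⊥-elim (0≢0 refl)
two-terms≤sum f {zero}  {suc j} _   = +-monoʳ-≤ (f zero) (term≤sum (f ∘ suc) j)
two-terms≤sum f {suc i} {zero}  _   = subst (_≤ sum f) (+-comm (f zero) (f (suc i)))
  (+-monoʳ-≤ (f zero) (term≤sum (f ∘ suc) i))
two-terms≤sum f {suc i} {suc j} i≢j = ≤-trans (two-terms≤sum (f ∘ suc) (i≢j ∘ cong suc)) (m≤n+m _ _)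

0<sum⇒∃0< : ∀ {n} (f : Fin n → ℕ) → 0 < sum f → ∃ λ i → 0 < f i
0<sum⇒∃0< {suc n} f 0<∑f with f zero in eq
... | suc _ = zero , subst (0 <_) (sym eq) (s≤s z≤n)
... | zero  = let i , 0<fi = 0<sum⇒∃0< (f ∘ suc) 0<∑f in suc i , 0<fi

sum≤1 : ∀ {n} (f : Fin n → ℕ) → (∀ i → f i ≤ 1) → (∀ i j → 0 < f i → 0 < f j → i ≡ j) → sum f ≤ 1
sum≤1 {zero}  f f≤1 unique = z≤n
sum≤1 {suc n} f f≤1 unique with f zero in eq
... | zero  = sum≤1 (f ∘ suc) (f≤1 ∘ suc) λ i j p q → Fin.suc-injective (unique (suc i) (suc j) p q)
... | suc k = begin
  suc k + sum (f ∘ suc) ≡⟨ cong (suc k +_) (sum-zero tail≡0) ⟩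
  suc k + 0             ≡⟨ cong (_+ 0) (sym eq) ⟩
  f zero + 0            ≤⟨ +-monoˡ-≤ 0 (f≤1 zero) ⟩
  1                     ∎
  where
  open ≤-Reasoning
  tail≡0 : ∀ i → f (suc i) ≡ 0
  tail≡0 i with f (suc i) in eqᵢ
  ... | zero  = refl
  ... | suc _ with () ← unique zero (suc i) (subst (0 <_) (sym eq) (s≤s z≤n)) (subst (0 <_) (sym eqᵢ) (s≤s z≤n))

∑²≤1 : ∀ {k l} (f : Fin k → Fin l → ℕ) → (∀ i j → f i j ≤ 1) →
  (∀ i j i′ j′ → 0 < f i j → 0 < f i′ j′ → i ≡ i′ × j ≡ j′) → ∑[ i < k ] ∑[ j < l ] f i j ≤ 1
∑²≤1 f f≤1 unique = sum≤1 (sum ∘ f)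
  (λ i → sum≤1 (f i) (f≤1 i) λ j j′ p p′ → proj₂ (unique i j i j′ p p′))
  λ i i′ p p′ → let j , pⱼ = 0<sum⇒∃0< (f i) p ; j′ , pⱼ′ = 0<sum⇒∃0< (f i′) p′
                in proj₁ (unique i j i′ j′ pⱼ pⱼ′)

two-terms≤∑² : ∀ {k l} (f : Fin k → Fin l → ℕ) {i i′ j j′} → ¬ (i ≡ i′ × j ≡ j′) →
  f i j + f i′ j′ ≤ ∑[ i < k ] ∑[ j < l ] f i j
two-terms≤∑² f {i} {i′} {j} {j′} ≢ with i ≟ i′
... | yes refl = ≤-trans (two-terms≤sum (f i) λ j≡j′ → ≢ (refl , j≡j′)) (term≤sum (sum ∘ f) i)
... | no i≢i′  = ≤-trans (+-mono-≤ (term≤sum (f i) j) (term≤sum (f i′) j′)) (two-terms≤sum (sum ∘ f) i≢i′)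

sum-δ : ∀ {n} (c : Fin n → ℕ) (x : Fin n) → ∑[ s < n ] (c s * χ (x ≟ s)) ≡ c x
sum-δ {suc n} c zero = begin
  c zero * 1 + ∑[ s < n ] (c (suc s) * χ (zero ≟ suc s))  ≡⟨ cong₂ _+_ (*-identityʳ (c zero)) (sum-zero off-diagonal) ⟩
  c zero + 0                                             ≡⟨ +-identityʳ (c zero) ⟩
  c zero                                                 ∎
  where
  open ≡-Reasoning
  off-diagonal : ∀ s → c (suc s) * χ (zero ≟ suc s) ≡ 0
  off-diagonal s = trans (cong (c (suc s) *_) (χ-no (zero ≟ suc s) λ ())) (*-zeroʳ (c (suc s)))
sum-δ {suc n} c (suc x) = begin
  c zero * 0 + ∑[ s < n ] (c (suc s) * χ (x ≟ s))  ≡⟨ cong (_+ ∑[ s < n ] (c (suc s) * χ (x ≟ s))) (*-zeroʳ (c zero)) ⟩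
  ∑[ s < n ] (c (suc s) * χ (x ≟ s))               ≡⟨ sum-δ (c ∘ suc) x ⟩
  c (suc x)                                        ∎
  where open ≡-Reasoning

sum-χ≟ : ∀ {n} (x : Fin n) → ∑[ s < n ] χ (x ≟ s) ≡ 1
sum-χ≟ x = trans (sum-cong-≗ λ s → sym (*-identityˡ (χ (x ≟ s)))) (sum-δ (λ _ → 1) x)

∑²-comm : ∀ {m k l} (v : Fin k → Fin l → ℕ) (g : Fin k → Fin l → Fin m → ℕ) →
  ∑[ x < m ] ∑[ i < k ] ∑[ j < l ] (v i j * g i j x) ≡ ∑[ i < k ] ∑[ j < l ] (v i j * ∑[ x < m ] g i j x)
∑²-comm v g = trans (∑-comm λ x i → ∑[ j < _ ] (v i j * g i j x))
  (sum-cong-≗ λ i → trans (∑-comm λ x j → v i j * g i j x) (sum-cong-≗ λ j → sym (*-distribˡ-sum (v i j) (g i j))))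

∑-comm-weighted : ∀ {m k} (c : Fin m → ℕ) (h : Fin k → Fin m → ℕ) →
  ∑[ x < m ] (c x * ∑[ i < k ] h i x) ≡ ∑[ i < k ] ∑[ x < m ] (c x * h i x)
∑-comm-weighted c h = trans (sum-cong-≗ λ x → *-distribˡ-sum (c x) (λ i → h i x)) (∑-comm λ x i → c x * h i x)

∑²-comm-weighted : ∀ {m k l} (c : Fin m → ℕ) (v : Fin k → Fin l → ℕ) (g : Fin k → Fin l → Fin m → ℕ) →
  ∑[ x < m ] (c x * ∑[ i < k ] ∑[ j < l ] (v i j * g i j x))
    ≡ ∑[ i < k ] ∑[ j < l ] (v i j * ∑[ x < m ] (c x * g i j x))
∑²-comm-weighted {m} {k} {l} c v g = begin
  ∑[ x < m ] (c x * ∑[ i < k ] ∑[ j < l ] (v i j * g i j x))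
    ≡⟨ ∑-comm-weighted c (λ i x → ∑[ j < l ] (v i j * g i j x)) ⟩
  ∑[ i < k ] ∑[ x < m ] (c x * ∑[ j < l ] (v i j * g i j x))
    ≡⟨ sum-cong-≗ (λ i → ∑-comm-weighted c (λ j x → v i j * g i j x)) ⟩
  ∑[ i < k ] ∑[ j < l ] ∑[ x < m ] (c x * (v i j * g i j x))
    ≡⟨ sum-cong-≗ (λ i → sum-cong-≗ λ j → sum-cong-≗ λ x → x∙yz≈y∙xz (c x) (v i j) (g i j x)) ⟩
  ∑[ i < k ] ∑[ j < l ] ∑[ x < m ] (v i j * (c x * g i j x))
    ≡⟨ sum-cong-≗ (λ i → sum-cong-≗ λ j → *-distribˡ-sum (v i j) (λ x → c x * g i j x)) ⟨
  ∑[ i < k ] ∑[ j < l ] (v i j * ∑[ x < m ] (c x * g i j x))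
    ∎
  where open ≡-Reasoning

∑²-δ-+ : ∀ {k l} (w : Fin k → Fin l → ℕ) c a b →
  ∑[ i < k ] ∑[ j < l ] (w i j * (χ (a ≟ i) * (χ (b ≟ j) * c) + 1)) ≡ w a b * c + ∑[ i < k ] ∑[ j < l ] w i j
∑²-δ-+ {k} {l} w c a b = begin
  ∑[ i < k ] ∑[ j < l ] (w i j * (χ (a ≟ i) * (χ (b ≟ j) * c) + 1))
    ≡⟨ sum-cong-≗ (λ i → sum-cong-≗ λ j → spread (w i j) (χ (a ≟ i)) (χ (b ≟ j)) c) ⟩
  ∑[ i < k ] ∑[ j < l ] ((w i j * c * χ (b ≟ j)) * χ (a ≟ i) + w i j)
    ≡⟨ sum-cong-≗ (λ i → ∑-distrib-+ (λ j → (w i j * c * χ (b ≟ j)) * χ (a ≟ i)) (w i)) ⟩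
  ∑[ i < k ] (∑[ j < l ] ((w i j * c * χ (b ≟ j)) * χ (a ≟ i)) + ∑[ j < l ] w i j)
    ≡⟨ sum-cong-≗ (λ i → cong (_+ sum (w i)) (row-δ i)) ⟩
  ∑[ i < k ] (w i b * c * χ (a ≟ i) + ∑[ j < l ] w i j)
    ≡⟨ ∑-distrib-+ (λ i → w i b * c * χ (a ≟ i)) (sum ∘ w) ⟩
  ∑[ i < k ] (w i b * c * χ (a ≟ i)) + ∑[ i < k ] ∑[ j < l ] w i j
    ≡⟨ cong (_+ ∑[ i < k ] ∑[ j < l ] w i j) (sum-δ (λ i → w i b * c) a) ⟩
  w a b * c + ∑[ i < k ] ∑[ j < l ] w i j ∎
  where
  open ≡-Reasoning
  spread : ∀ w x y c → w * (x * (y * c) + 1) ≡ (w * c * y) * x + w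
  spread = solve-∀
  row-δ : ∀ i → ∑[ j < l ] ((w i j * c * χ (b ≟ j)) * χ (a ≟ i)) ≡ w i b * c * χ (a ≟ i)
  row-δ i = trans (sym (*-distribʳ-sum (χ (a ≟ i)) (λ j → w i j * c * χ (b ≟ j))))
                  (cong (_* χ (a ≟ i)) (sum-δ (λ j → w i j * c) b))

χ-any : ∀ {n p} {P : Fin n → Set p} (P? : ∀ i → Dec (P i)) → χ (any? P?) ≡ sum (χ ∘ P?) ⊓ 1
χ-any P? with any? P?
... | yes (i , pᵢ) = sym (m≥n⇒m⊓n≡n (≤-trans (≤-reflexive (sym (χ-yes (P? i) pᵢ))) (term≤sum (χ ∘ P?) i)))
... | no ¬∃p       = cong (_⊓ 1) (sym (sum-zero λ i → χ-no (P? i) λ pᵢ → ¬∃p (i , pᵢ)))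

sum-⊓1 : ∀ {n} (f : Fin n → ℕ) → sum (λ i → f i ⊓ 1) ⊓ 1 ≡ sum f ⊓ 1
sum-⊓1 {zero}  f = refl
sum-⊓1 {suc n} f with f zero
... | zero  = sum-⊓1 (f ∘ suc)
... | suc k = trans (m≥n⇒m⊓n≡n (s≤s z≤n)) (sym (m≥n⇒m⊓n≡n (s≤s z≤n)))

am-gm-≤ : ∀ {a b} → a ≤ b → 2 * (a * b) ≤ a * a + b * b
am-gm-≤ {a} a≤b with d , refl ← m≤n⇒∃[o]m+o≡n a≤b =
  subst (2 * (a * (a + d)) ≤_) (square-gap a d) (m≤m+n _ (d * d))
  where
  square-gap : ∀ a d → 2 * (a * (a + d)) + d * d ≡ a * a + (a + d) * (a + d)
  square-gap = solve-∀

am-gm : ∀ a b → 2 * (a * b) ≤ a * a + b * b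
am-gm a b with ≤-total a b
... | inj₁ a≤b = am-gm-≤ a≤b
... | inj₂ b≤a = subst₂ _≤_ (cong (2 *_) (*-comm b a)) (+-comm (b * b) (a * a)) (am-gm-≤ b≤a)

cauchy-schwarz-step : ∀ x S P T → S * S ≤ P * T → (x + S) * (x + S) ≤ (1 + P) * (x * x + T)
cauchy-schwarz-step x zero    zero T _ = subst ((x + 0) * (x + 0) ≤_) (x²+T x T) (m≤m+n _ T)
  where
  x²+T : ∀ x T → (x + 0) * (x + 0) + T ≡ (1 + 0) * (x * x + T)
  x²+T = solve-∀
cauchy-schwarz-step x S P@(suc _) T S²≤PT = begin
  (x + S) * (x + S)                  ≡⟨ expand x S ⟩
  x * x + 2 * (x * S) + S * S        ≤⟨ +-mono-≤ (+-monoʳ-≤ (x * x) cross) S²≤PT ⟩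
  x * x + (T + P * (x * x)) + P * T  ≡⟨ collect x T P ⟩
  (1 + P) * (x * x + T)              ∎
  where
  open ≤-Reasoning
  expand : ∀ x S → (x + S) * (x + S) ≡ x * x + 2 * (x * S) + S * S
  expand = solve-∀
  collect : ∀ x T P → x * x + (T + P * (x * x)) + P * T ≡ (1 + P) * (x * x + T)
  collect = solve-∀
  cross : 2 * (x * S) ≤ T + P * (x * x)
  cross = *-cancelˡ-≤ P (begin
    P * (2 * (x * S))            ≡⟨ regroup P x S ⟩
    2 * ((P * x) * S)            ≤⟨ am-gm (P * x) S ⟩
    P * x * (P * x) + S * S      ≤⟨ +-monoʳ-≤ (P * x * (P * x)) S²≤PT ⟩
    P * x * (P * x) + P * T      ≡⟨ factor P x T ⟩
    P * (T + P * (x * x))        ∎)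
    where
    regroup : ∀ P x S → P * (2 * (x * S)) ≡ 2 * ((P * x) * S)
    regroup = solve-∀
    factor : ∀ P x T → P * x * (P * x) + P * T ≡ P * (T + P * (x * x))
    factor = solve-∀

cauchy-schwarz : ∀ {n} (f : Fin n → ℕ) → sum f * sum f ≤ sum (λ i → f i ⊓ 1) * sum (λ i → f i * f i)
cauchy-schwarz {zero}  f = z≤n
cauchy-schwarz {suc n} f with f zero
... | zero  = cauchy-schwarz (f ∘ suc)
... | suc k rewrite ⊓-zeroʳ k =
  cauchy-schwarz-step (suc k) (sum (f ∘ suc)) (sum (λ i → f (suc i) ⊓ 1)) (sum (λ i → f (suc i) * f (suc i)))
    (cauchy-schwarz (f ∘ suc))

average-attained : ∀ {n} (w f : Fin n → ℕ) → 0 < sum w →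
  ∃ λ i → 0 < w i × sum w * f i ≤ ∑[ j < n ] (w j * f j)
average-attained {n} w f 0<W
  with any? (λ i → (0 <? w i) ×-dec (sum w * f i ≤? ∑[ j < n ] (w j * f j))) | 0<sum⇒∃0< w 0<W
... | yes witness | _        = witness
-- Otherwise weighting the strict inequalities ∑ w f < W · f i by w gives W · ∑ w f < W · ∑ w f.
... | no ¬below   | k , 0<wₖ = ⊥-elim (<-irrefl refl (begin-strict
  W * ∑wf                      ≡⟨ *-distribʳ-sum ∑wf w ⟩
  ∑[ i < n ] (w i * ∑wf)       <⟨ sum-mono-< above k (*-monoʳ-< (w k) {{>-nonZero 0<wₖ}} (over k 0<wₖ)) ⟩
  ∑[ i < n ] (w i * (W * f i)) ≡⟨ sum-cong-≗ (λ i → x∙yz≈y∙xz (w i) W (f i)) ⟩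
  ∑[ i < n ] (W * (w i * f i)) ≡⟨ *-distribˡ-sum W (λ i → w i * f i) ⟨
  W * ∑wf                      ∎))
  where
  open ≤-Reasoning
  W ∑wf : ℕ
  W = sum w
  ∑wf = ∑[ j < n ] (w j * f j)
  over : ∀ i → 0 < w i → ∑wf < W * f i
  over i 0<wᵢ = ≰⇒> λ below → ¬below (i , 0<wᵢ , below)
  above : ∀ i → w i * ∑wf ≤ w i * (W * f i)
  above i with 0 <? w i
  ... | yes 0<wᵢ = *-monoʳ-≤ (w i) (<⇒≤ (over i 0<wᵢ))
  ... | no  0≮wᵢ rewrite n≤0⇒n≡0 (≮⇒≥ 0≮wᵢ) = z≤n

N²≤se∧ge≤N[g+N]⇒Ng≤s[N+g] : ∀ {N s e g} → 0 < N → N * N ≤ s * e → g * e ≤ N * (g + N) →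
  N * g ≤ s * (N + g)
N²≤se∧ge≤N[g+N]⇒Ng≤s[N+g] {N} {s} {e} {g} 0<N N²≤se ge≤N[g+N] =
  *-cancelˡ-≤ N {{>-nonZero 0<N}} (begin
  N * (N * g)         ≡⟨ *-assoc N N g ⟨
  N * N * g           ≤⟨ *-monoˡ-≤ g N²≤se ⟩
  s * e * g           ≡⟨ xy∙z≈x∙zy s e g ⟩
  s * (g * e)         ≤⟨ *-monoʳ-≤ s ge≤N[g+N] ⟩
  s * (N * (g + N))   ≡⟨ regroup s N g ⟩
  N * (s * (N + g))   ∎)
  where
  open ≤-Reasoning
  regroup : ∀ s N g → s * (N * (g + N)) ≡ N * (s * (N + g))
  regroup = solve-∀

-- Counting subsets and lists

∣p∣≡∑χ : ∀ {n} (p : Subset n) → ∣ p ∣ ≡ ∑[ i < n ] χ (i ∈? p)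
∣p∣≡∑χ []            = refl
∣p∣≡∑χ (inside  ∷ p) = cong suc (∣p∣≡∑χ p)
∣p∣≡∑χ (outside ∷ p) = ∣p∣≡∑χ p

∣tabulate∣≡∑χ : ∀ {n p} {P : Fin n → Set p} (P? : ∀ i → Dec (P i)) →
  ∣ tabulate (does ∘ P?) ∣ ≡ sum (χ ∘ P?)
∣tabulate∣≡∑χ {zero}  P? = refl
∣tabulate∣≡∑χ {suc n} P? with does (P? zero)
... | true  = cong suc (∣tabulate∣≡∑χ (P? ∘ suc))
... | false = ∣tabulate∣≡∑χ (P? ∘ suc)

length-filter-tabulate : ∀ {a p} {X : Set a} {P : Pred X p} (P? : Decidable P) {n} (f : Fin n → X) →
  length (filter P? (List.tabulate f)) ≡ sum (χ ∘ P? ∘ f)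
length-filter-tabulate P? {zero}  f = refl
length-filter-tabulate P? {suc n} f with does (P? (f zero))
... | true  = cong suc (length-filter-tabulate P? (f ∘ suc))
... | false = length-filter-tabulate P? (f ∘ suc)

length-filter-cartesianProduct : ∀ {a p} {Y : Set a} {m k} {P : Pred (Y × Fin k) p}
  (P? : Decidable P) (f : Fin m → Y) →
  length (filter P? (cartesianProduct (List.tabulate f) (allFin k))) ≡ ∑[ i < m ] ∑[ j < k ] χ (P? (f i , j))
length-filter-cartesianProduct {m = zero}      P? f = refl
length-filter-cartesianProduct {Y = Y} {m = suc m} {k} P? f = begin
  length (filter P? (map (f zero ,_) (allFin k) ++ rest))
    ≡⟨ cong length (filter-++ P? (map (f zero ,_) (allFin k)) rest) ⟩
  length (filter P? (map (f zero ,_) (allFin k)) ++ filter P? rest)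
    ≡⟨ length-++ (filter P? (map (f zero ,_) (allFin k))) ⟩
  length (filter P? (map (f zero ,_) (allFin k))) + length (filter P? rest)
    ≡⟨ cong₂ _+_ (trans (cong (length ∘ filter P?) (map-tabulate id (f zero ,_))) (length-filter-tabulate P? (f zero ,_)))
                 (length-filter-cartesianProduct P? (f ∘ suc)) ⟩
  ∑[ i < suc m ] ∑[ j < k ] χ (P? (f i , j)) ∎
  where
  open ≡-Reasoning
  rest : List (Y × Fin k)
  rest = cartesianProduct (List.tabulate (f ∘ suc)) (allFin k)

∈-tabulate : ∀ {n p} {P : Fin n → Set p} (P? : ∀ i → Dec (P i)) {i} → P i → i ∈ tabulate (does ∘ P?)
∈-tabulate P? {i} pᵢ = lookup⇒[]= i _ (trans (lookup∘tabulate (does ∘ P?) i) (dec-true (P? i) pᵢ))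

x∈p⇒0<∣p∣ : ∀ {n} {x : Fin n} {p} → x ∈ p → 0 < ∣ p ∣
x∈p⇒0<∣p∣ {x = x} {p} x∈p =
  subst (0 <_) (sym (∣p∣≡∑χ p)) (subst (_≤ _) (χ-yes (x ∈? p) x∈p) (term≤sum (λ i → χ (i ∈? p)) x))

two-elements : ∀ {n} (p : Subset n) → 1 < ∣ p ∣ → ∃ λ x → ∃ λ y → x ∈ p × y ∈ p × x ≢ y
two-elements {n} p 1<∣p∣ with nonempty? p
... | no empty with () ← subst (1 <_) (trans (cong ∣_∣ (Empty-unique empty)) (∣⊥∣≡0 n)) 1<∣p∣
... | yes (x , x∈p) with any? (λ y → (y ∈? p) ×-dec ¬? (y ≟ x))
...   | yes (y , y∈p , y≢x) = y , x , y∈p , x∈p , y≢x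
...   | no ¬other = ⊥-elim (<⇒≱ 1<∣p∣ (≤-trans (p⊆q⇒∣p∣≤∣q∣ p⊆⁅x⁆) (≤-reflexive (∣⁅x⁆∣≡1 x))))
  where
  p⊆⁅x⁆ : p ⊆ ⁅ x ⁆
  p⊆⁅x⁆ {y} y∈p =
    subst (_∈ ⁅ x ⁆) (sym (decidable-stable (y ≟ x) λ y≢x → ¬other (y , y∈p , y≢x))) (x∈⁅x⁆ x)

injection-bound : ∀ {k l m t} {T : Fin k → Fin l → Set t} (T? : ∀ i j → Dec (T i j))
  (g : Fin k → Fin l → Fin m) (P : Subset m) →
  (∀ {i j} → T i j → g i j ∈ P) →
  (∀ {i j i′ j′} → T i j → T i′ j′ → g i j ≡ g i′ j′ → i ≡ i′ × j ≡ j′) →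
  ∑[ i < k ] ∑[ j < l ] χ (T? i j) ≤ ∣ P ∣
injection-bound {k} {l} {m} T? g P g[T]⊆P g-injective = begin
  ∑[ i < k ] ∑[ j < l ] χ (T? i j)
    ≡⟨ sum-cong-≗ (λ i → sum-cong-≗ λ j → sym (hits-once i j)) ⟩
  ∑[ i < k ] ∑[ j < l ] (χ (T? i j) * ∑[ s < m ] χ (g i j ≟ s))
    ≡⟨ ∑²-comm (λ i j → χ (T? i j)) (λ i j s → χ (g i j ≟ s)) ⟨
  ∑[ s < m ] preimage s
    ≤⟨ sum-mono-≤ (λ s → ≤χ (s ∈? P) (preimage≤1 s) (preimage⊆P s)) ⟩
  ∑[ s < m ] χ (s ∈? P)
    ≡⟨ ∣p∣≡∑χ P ⟨
  ∣ P ∣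
    ∎
  where
  open ≤-Reasoning
  hits-once : ∀ i j → χ (T? i j) * ∑[ s < m ] χ (g i j ≟ s) ≡ χ (T? i j)
  hits-once i j = trans (cong (χ (T? i j) *_) (sum-χ≟ (g i j))) (*-identityʳ (χ (T? i j)))
  preimage : Fin m → ℕ
  preimage s = ∑[ i < k ] ∑[ j < l ] (χ (T? i j) * χ (g i j ≟ s))
  preimage≤1 : ∀ s → preimage s ≤ 1
  preimage≤1 s = ∑²≤1 _ (λ i j → *-mono-≤ (χ≤1 (T? i j)) (χ≤1 (g i j ≟ s))) λ i j i′ j′ p p′ →
    let t , gᵢⱼ≡s = 0<χ*χ⇒ (T? i j) (g i j ≟ s) p
        t′ , gᵢ′ⱼ′≡s = 0<χ*χ⇒ (T? i′ j′) (g i′ j′ ≟ s) p′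
    in g-injective t t′ (trans gᵢⱼ≡s (sym gᵢ′ⱼ′≡s))
  preimage⊆P : ∀ s → 0 < preimage s → s ∈ P
  preimage⊆P s 0<pre =
    let i , 0<rowᵢ = 0<sum⇒∃0< _ 0<pre ; j , 0<termᵢⱼ = 0<sum⇒∃0< _ 0<rowᵢ
        t , gᵢⱼ≡s = 0<χ*χ⇒ (T? i j) (g i j ≟ s) 0<termᵢⱼ
    in subst (_∈ P) gᵢⱼ≡s (g[T]⊆P t)

-- Arithmetic modulo q

module Congruence (q : ℕ) .{{_ : NonZero q}} where

  ≈-setoid : Setoid _ _
  ≈-setoid = On.setoid (setoid ℕ) (_% q)

  open Setoid ≈-setoid public using (_≈_) renaming (refl to ≈-refl; sym to ≈-sym; trans to ≈-trans)
  module ≈-Reasoning = Relation.Binary.Reasoning.Setoid ≈-setoid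

  %-≈ : ∀ x → x % q ≈ x
  %-≈ x = m%n%n≡m%n x q

  ≈-+ : ∀ {x x′ y y′} → x ≈ x′ → y ≈ y′ → x + y ≈ x′ + y′
  ≈-+ {x} {x′} {y} {y′} x≈x′ y≈y′ = begin
    (x + y) % q              ≡⟨ %-distribˡ-+ x y q ⟩
    (x % q + y % q) % q      ≡⟨ cong₂ (λ a b → (a + b) % q) x≈x′ y≈y′ ⟩
    (x′ % q + y′ % q) % q    ≡⟨ %-distribˡ-+ x′ y′ q ⟨
    (x′ + y′) % q            ∎
    where open ≡-Reasoning

  ≈-* : ∀ {x x′ y y′} → x ≈ x′ → y ≈ y′ → x * y ≈ x′ * y′
  ≈-* {x} {x′} {y} {y′} x≈x′ y≈y′ = begin
    (x * y) % q              ≡⟨ %-distribˡ-* x y q ⟩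
    (x % q * (y % q)) % q    ≡⟨ cong₂ (λ a b → (a * b) % q) x≈x′ y≈y′ ⟩
    (x′ % q * (y′ % q)) % q  ≡⟨ %-distribˡ-* x′ y′ q ⟨
    (x′ * y′) % q            ∎
    where open ≡-Reasoning

  ≈⇒≡ : ∀ {x y} → x < q → y < q → x ≈ y → x ≡ y
  ≈⇒≡ x<q y<q x≈y = trans (sym (m<n⇒m%n≡m x<q)) (trans x≈y (m<n⇒m%n≡m y<q))

  m+k≈m⇒q∣k : ∀ m k → m + k ≈ m → q ∣ k
  m+k≈m⇒q∣k m k m+k≈m = divides (a ∸ b) (begin
    k                                      ≡⟨ m+n∸m≡n m k ⟨
    m + k ∸ m                              ≡⟨ cong₂ _∸_ (m≡m%n+[m/n]*n (m + k) q) (m≡m%n+[m/n]*n m q) ⟩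
    ((m + k) % q + a * q) ∸ (m % q + b * q) ≡⟨ cong (λ r → (r + a * q) ∸ (m % q + b * q)) m+k≈m ⟩
    (m % q + a * q) ∸ (m % q + b * q)       ≡⟨ [m+n]∸[m+o]≡n∸o (m % q) (a * q) (b * q) ⟩
    a * q ∸ b * q                          ≡⟨ *-distribʳ-∸ q a b ⟨
    (a ∸ b) * q                            ∎)
    where
    open ≡-Reasoning
    a b : ℕ
    a = (m + k) / q
    b = m / q

  +-cancelˡ-≈-≤ : ∀ z {x y} → x ≤ y → z + x ≈ z + y → x ≈ y
  +-cancelˡ-≈-≤ z {x} x≤y z+x≈z+y with t , refl ← m≤n⇒∃[o]m+o≡n x≤y =
    sym (%-remove-+ʳ x (m+k≈m⇒q∣k (z + x) t (trans (cong (_% q) (+-assoc z x t)) (sym z+x≈z+y))))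

  +-cancelˡ-≈ : ∀ z {x y} → z + x ≈ z + y → x ≈ y
  +-cancelˡ-≈ z {x} {y} z+x≈z+y with ≤-total x y
  ... | inj₁ x≤y = +-cancelˡ-≈-≤ z x≤y z+x≈z+y
  ... | inj₂ y≤x = ≈-sym (+-cancelˡ-≈-≤ z y≤x (≈-sym z+x≈z+y))

  q∣n<q⇒n≡0 : ∀ {n} → q ∣ n → n < q → n ≡ 0
  q∣n<q⇒n≡0 {n} q∣n n<q = trans (sym (m<n⇒m%n≡m n<q)) (n∣m⇒m%n≡0 n q q∣n)

  -- (ux + vy) − (vx + uy) = (v − u)(y − x), written with v = u + s and y = x + t to avoid truncated subtraction.
  cross-difference : ∀ u s x t → u * x + (u + s) * (x + t) ≡ (u + s) * x + u * (x + t) + s * t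
  cross-difference = solve-∀

  module _ (prime : Prime q) where

    ux+vy≈vx+uy⇒x≡y-≤ : ∀ {u v x y} → v < q → y < q → u ≢ v → u ≤ v → x ≤ y →
      u * x + v * y ≈ v * x + u * y → x ≡ y
    ux+vy≈vx+uy⇒x≡y-≤ {u} {v} {x} {y} v<q y<q u≢v u≤v x≤y cross≈
      with s , refl ← m≤n⇒∃[o]m+o≡n u≤v | t , refl ← m≤n⇒∃[o]m+o≡n x≤y
      with euclidsLemma s t prime (m+k≈m⇒q∣k _ (s * t) (trans (cong (_% q) (sym (cross-difference u s x t))) cross≈))
    ... | inj₁ q∣s = ⊥-elim (u≢v (sym (trans (cong (u +_) (q∣n<q⇒n≡0 q∣s (≤-<-trans (m≤n+m s u) v<q)))
                                               (+-identityʳ u))))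
    ... | inj₂ q∣t = sym (trans (cong (x +_) (q∣n<q⇒n≡0 q∣t (≤-<-trans (m≤n+m t x) y<q))) (+-identityʳ x))

    ux+vy≈vx+uy⇒x≡y-u≤v : ∀ {u v x y} → v < q → x < q → y < q → u ≢ v → u ≤ v →
      u * x + v * y ≈ v * x + u * y → x ≡ y
    ux+vy≈vx+uy⇒x≡y-u≤v {u} {v} {x} {y} v<q x<q y<q u≢v u≤v cross≈ with ≤-total x y
    ... | inj₁ x≤y = ux+vy≈vx+uy⇒x≡y-≤ v<q y<q u≢v u≤v x≤y cross≈
    ... | inj₂ y≤x = sym (ux+vy≈vx+uy⇒x≡y-≤ v<q x<q u≢v u≤v y≤x cross≈′)
      where
      cross≈′ : u * y + v * x ≈ v * y + u * x
      cross≈′ = trans (cong (_% q) (+-comm (u * y) (v * x)))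
                      (trans (sym cross≈) (cong (_% q) (+-comm (u * x) (v * y))))

    ux+vy≈vx+uy⇒x≡y : ∀ {u v x y} → u < q → v < q → x < q → y < q → u ≢ v →
      u * x + v * y ≈ v * x + u * y → x ≡ y
    ux+vy≈vx+uy⇒x≡y {u} {v} u<q v<q x<q y<q u≢v cross≈ with ≤-total u v
    ... | inj₁ u≤v = ux+vy≈vx+uy⇒x≡y-u≤v v<q x<q y<q u≢v u≤v cross≈
    ... | inj₂ v≤u = ux+vy≈vx+uy⇒x≡y-u≤v u<q x<q y<q (u≢v ∘ sym) v≤u (≈-sym cross≈)

module Residues (q : ℕ) .{{_ : NonZero q}} where

  open Congruence q

  toℕ-·F : ∀ a b → toℕ (a ·F b) ≈ toℕ a * toℕ b
  toℕ-·F a b = trans (cong (_% q) (toℕ-fromℕ< _)) (%-≈ (toℕ a * toℕ b))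

  toℕ-+F : ∀ a b → toℕ (a +F b) ≈ toℕ a + toℕ b
  toℕ-+F a b = trans (cong (_% q) (toℕ-fromℕ< _)) (%-≈ (toℕ a + toℕ b))

  toℕ-oneF : toℕ (oneF {q}) ≈ 1
  toℕ-oneF = trans (cong (_% q) (toℕ-fromℕ< _)) (%-≈ 1)

  toℕ-+F·F : ∀ a b ξ → toℕ (a +F (b ·F ξ)) ≈ toℕ a + toℕ b * toℕ ξ
  toℕ-+F·F a b ξ = ≈-trans (toℕ-+F a (b ·F ξ)) (≈-+ {toℕ a} refl (toℕ-·F b ξ))

  ≈⇒≡ᶠ : ∀ {a b : Fin q} → toℕ a ≈ toℕ b → a ≡ b
  ≈⇒≡ᶠ {a} {b} a≈b = toℕ-injective (≈⇒≡ (toℕ<n a) (toℕ<n b) a≈b)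

  ≡⇒≈ᶠ : ∀ {a b : Fin q} → a ≡ b → toℕ a ≈ toℕ b
  ≡⇒≈ᶠ refl = refl

  ·F-comm : ∀ a b → a ·F b ≡ b ·F a
  ·F-comm a b = ≈⇒≡ᶠ (begin
    toℕ (a ·F b)     ≈⟨ toℕ-·F a b ⟩
    toℕ a * toℕ b    ≡⟨ *-comm (toℕ a) (toℕ b) ⟩
    toℕ b * toℕ a    ≈⟨ toℕ-·F b a ⟨
    toℕ (b ·F a)     ∎)
    where open ≈-Reasoning

  ·F-assoc : ∀ a b c → (a ·F b) ·F c ≡ a ·F (b ·F c)
  ·F-assoc a b c = ≈⇒≡ᶠ (begin
    toℕ ((a ·F b) ·F c)        ≈⟨ toℕ-·F (a ·F b) c ⟩
    toℕ (a ·F b) * toℕ c       ≈⟨ ≈-* (toℕ-·F a b) (≈-refl {toℕ c}) ⟩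
    toℕ a * toℕ b * toℕ c      ≡⟨ *-assoc (toℕ a) (toℕ b) (toℕ c) ⟩
    toℕ a * (toℕ b * toℕ c)    ≈⟨ ≈-* (≈-refl {toℕ a}) (toℕ-·F b c) ⟨
    toℕ a * toℕ (b ·F c)       ≈⟨ toℕ-·F a (b ·F c) ⟨
    toℕ (a ·F (b ·F c))        ∎)
    where open ≈-Reasoning

  ·F-identityʳ : ∀ a → a ·F oneF ≡ a
  ·F-identityʳ a = ≈⇒≡ᶠ (begin
    toℕ (a ·F oneF)      ≈⟨ toℕ-·F a oneF ⟩
    toℕ a * toℕ oneF     ≈⟨ ≈-* (≈-refl {toℕ a}) toℕ-oneF ⟩
    toℕ a * 1            ≡⟨ *-identityʳ (toℕ a) ⟩
    toℕ a                ∎)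
    where open ≈-Reasoning

  ·F-identityˡ : ∀ a → oneF ·F a ≡ a
  ·F-identityˡ a = trans (·F-comm oneF a) (·F-identityʳ a)

  ·F-rotate : ∀ d ξ h → d ·F (ξ ·F h) ≡ (h ·F d) ·F ξ
  ·F-rotate d ξ h = trans (·F-comm d (ξ ·F h)) (trans (·F-assoc ξ h d) (·F-comm ξ (h ·F d)))

  +F-comm : ∀ a b → a +F b ≡ b +F a
  +F-comm a b = ≈⇒≡ᶠ (begin
    toℕ (a +F b)     ≈⟨ toℕ-+F a b ⟩
    toℕ a + toℕ b    ≡⟨ +-comm (toℕ a) (toℕ b) ⟩
    toℕ b + toℕ a    ≈⟨ toℕ-+F b a ⟨
    toℕ (b +F a)     ∎)
    where open ≈-Reasoning

  +F-cancelʳ : ∀ {a a′} x → a +F x ≡ a′ +F x → a ≡ a′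
  +F-cancelʳ {a} {a′} x a+x≡a′+x = ≈⇒≡ᶠ (+-cancelˡ-≈ (toℕ x) (begin
    toℕ x + toℕ a    ≡⟨ +-comm (toℕ x) (toℕ a) ⟩
    toℕ a + toℕ x    ≈⟨ toℕ-+F a x ⟨
    toℕ (a +F x)     ≡⟨ cong toℕ a+x≡a′+x ⟩
    toℕ (a′ +F x)    ≈⟨ toℕ-+F a′ x ⟩
    toℕ a′ + toℕ x   ≡⟨ +-comm (toℕ a′) (toℕ x) ⟩
    toℕ x + toℕ a′   ∎))
    where open ≈-Reasoning

  module _ (prime : Prime q) where

    ·F-cancelˡ : ∀ {h d d′} → toℕ h ≢ 0 → h ·F d ≡ h ·F d′ → d ≡ d′
    ·F-cancelˡ {h} {d} {d′} h≢0 hd≡hd′ = toℕ-injective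
      (ux+vy≈vx+uy⇒x≡y prime (≤-<-trans z≤n (toℕ<n h)) (toℕ<n h) (toℕ<n d) (toℕ<n d′) (h≢0 ∘ sym) (begin
        0 * toℕ d + toℕ h * toℕ d′   ≡⟨⟩
        toℕ h * toℕ d′               ≈⟨ toℕ-·F h d′ ⟨
        toℕ (h ·F d′)                ≡⟨ cong toℕ hd≡hd′ ⟨
        toℕ (h ·F d)                 ≈⟨ toℕ-·F h d ⟩
        toℕ h * toℕ d                ≡⟨ +-identityʳ (toℕ h * toℕ d) ⟨
        toℕ h * toℕ d + 0 * toℕ d′   ∎))
      where open ≈-Reasoning

    lines-meet-once : ∀ {a b a′ b′ ξ η} → ¬ (a ≡ a′ × b ≡ b′) →
      a +F (b ·F ξ) ≡ a′ +F (b′ ·F ξ) → a +F (b ·F η) ≡ a′ +F (b′ ·F η) → ξ ≡ η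
    lines-meet-once {a} {b} {a′} {b′} {ξ} {η} distinct meetξ meetη with b ≟ b′
    ... | yes refl = ⊥-elim (distinct (+F-cancelʳ (b ·F ξ) meetξ , refl))
    ... | no b≢b′  = toℕ-injective
      (ux+vy≈vx+uy⇒x≡y prime (toℕ<n b) (toℕ<n b′) (toℕ<n ξ) (toℕ<n η) (b≢b′ ∘ toℕ-injective)
        (+-cancelˡ-≈ (toℕ a + toℕ a′) (begin
          toℕ a + toℕ a′ + (toℕ b * toℕ ξ + toℕ b′ * toℕ η)
            ≡⟨ interleave (toℕ a) (toℕ a′) (toℕ b * toℕ ξ) (toℕ b′ * toℕ η) ⟩
          (toℕ a + toℕ b * toℕ ξ) + (toℕ a′ + toℕ b′ * toℕ η)
            ≈⟨ ≈-+ (meets meetξ) (≈-sym (meets meetη)) ⟩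
          (toℕ a′ + toℕ b′ * toℕ ξ) + (toℕ a + toℕ b * toℕ η)
            ≡⟨ interleave′ (toℕ a) (toℕ a′) (toℕ b′ * toℕ ξ) (toℕ b * toℕ η) ⟩
          toℕ a + toℕ a′ + (toℕ b′ * toℕ ξ + toℕ b * toℕ η)
            ∎)))
      where
      open ≈-Reasoning
      meets : ∀ {x} → a +F (b ·F x) ≡ a′ +F (b′ ·F x) → toℕ a + toℕ b * toℕ x ≈ toℕ a′ + toℕ b′ * toℕ x
      meets {x} meet = ≈-trans (≈-sym (toℕ-+F·F a b x)) (≈-trans (≡⇒≈ᶠ meet) (toℕ-+F·F a′ b′ x))
      interleave : ∀ a a′ y z → a + a′ + (y + z) ≡ (a + y) + (a′ + z)
      interleave = solve-∀
      interleave′ : ∀ a a′ y z → (a′ + y) + (a + z) ≡ a + a′ + (y + z)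
      interleave′ = solve-∀

-- The sumsets S ξ A

module Sumsets (q : ℕ) .{{_ : NonZero q}} (A : Subset q) where

  open Residues q

  𝟙A : Fin q → ℕ
  𝟙A a = χ (a ∈? A)

  𝟙A² : Fin q → Fin q → ℕ
  𝟙A² a b = 𝟙A a * 𝟙A b

  lin : Fin q → Fin q → Fin q → Fin q
  lin ξ a b = a +F (b ·F ξ)

  rep : Fin q → Fin q → ℕ
  rep ξ s = ∑[ a < q ] ∑[ b < q ] (𝟙A² a b * χ (lin ξ a b ≟ s))

  Deficient : Fin q → Set
  Deficient ξ = ∣ S ξ A ∣ < ∣ A ∣ ^ 2

  Deficient? : ∀ ξ → Dec (Deficient ξ)
  Deficient? ξ = ∣ S ξ A ∣ <? ∣ A ∣ ^ 2

  ∑𝟙A²≡∣A∣^2 : ∑[ a < q ] ∑[ b < q ] 𝟙A² a b ≡ ∣ A ∣ ^ 2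
  ∑𝟙A²≡∣A∣^2 = begin
    ∑[ a < q ] ∑[ b < q ] (𝟙A a * 𝟙A b)  ≡⟨ sum-cong-≗ (λ a → *-distribˡ-sum (𝟙A a) 𝟙A) ⟨
    ∑[ a < q ] (𝟙A a * sum 𝟙A)          ≡⟨ *-distribʳ-sum (sum 𝟙A) 𝟙A ⟨
    sum 𝟙A * sum 𝟙A                     ≡⟨ cong (λ n → n * n) (∣p∣≡∑χ A) ⟨
    ∣ A ∣ * ∣ A ∣                        ≡⟨ cong (∣ A ∣ *_) (*-identityʳ ∣ A ∣) ⟨
    ∣ A ∣ ^ 2                            ∎
    where open ≡-Reasoning

  ∑rep≡∣A∣^2 : ∀ ξ → ∑[ s < q ] rep ξ s ≡ ∣ A ∣ ^ 2
  ∑rep≡∣A∣^2 ξ = begin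
    ∑[ s < q ] rep ξ s
      ≡⟨ ∑²-comm 𝟙A² (λ a b s → χ (lin ξ a b ≟ s)) ⟩
    ∑[ a < q ] ∑[ b < q ] (𝟙A² a b * ∑[ s < q ] χ (lin ξ a b ≟ s))
      ≡⟨ sum-cong-≗ (λ a → sum-cong-≗ λ b → cong (𝟙A² a b *_) (sum-χ≟ (lin ξ a b))) ⟩
    ∑[ a < q ] ∑[ b < q ] (𝟙A² a b * 1)
      ≡⟨ sum-cong-≗ (λ a → sum-cong-≗ λ b → *-identityʳ (𝟙A² a b)) ⟩
    ∑[ a < q ] ∑[ b < q ] 𝟙A² a b
      ≡⟨ ∑𝟙A²≡∣A∣^2 ⟩
    ∣ A ∣ ^ 2
      ∎
    where open ≡-Reasoning

  pair? : ∀ ξ s a b → Dec (a ∈ A × b ∈ A × lin ξ a b ≡ s)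
  pair? ξ s a b = (a ∈? A) ×-dec ((b ∈? A) ×-dec (lin ξ a b ≟ s))

  represented? : ∀ ξ s → Dec (∃ λ a → ∃ λ b → a ∈ A × b ∈ A × lin ξ a b ≡ s)
  represented? ξ s = any? λ a → any? λ b → pair? ξ s a b

  lin∈S : ∀ {ξ a b} → a ∈ A → b ∈ A → lin ξ a b ∈ S ξ A
  lin∈S {ξ} {a} {b} a∈A b∈A = ∈-tabulate (represented? ξ) (a , b , a∈A , b∈A , refl)

  ∣S∣≡∑rep⊓1 : ∀ ξ → ∣ S ξ A ∣ ≡ ∑[ s < q ] (rep ξ s ⊓ 1)
  ∣S∣≡∑rep⊓1 ξ = trans (∣tabulate∣≡∑χ (represented? ξ)) (sum-cong-≗ λ s → begin
    χ (represented? ξ s)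
      ≡⟨ χ-any (λ a → any? λ b → pair? ξ s a b) ⟩
    ∑[ a < q ] χ (any? (pair? ξ s a)) ⊓ 1
      ≡⟨ cong (_⊓ 1) (sum-cong-≗ λ a → χ-any (pair? ξ s a)) ⟩
    ∑[ a < q ] (∑[ b < q ] χ (pair? ξ s a b) ⊓ 1) ⊓ 1
      ≡⟨ sum-⊓1 (λ a → ∑[ b < q ] χ (pair? ξ s a b)) ⟩
    ∑[ a < q ] ∑[ b < q ] χ (pair? ξ s a b) ⊓ 1
      ≡⟨ cong (_⊓ 1) (sum-cong-≗ λ a → sum-cong-≗ λ b → χ-pair s a b) ⟩
    rep ξ s ⊓ 1
      ∎)
    where
    open ≡-Reasoning
    χ-pair : ∀ s a b → χ (pair? ξ s a b) ≡ 𝟙A² a b * χ (lin ξ a b ≟ s)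
    χ-pair s a b = trans (χ-×-dec (a ∈? A) ((b ∈? A) ×-dec (lin ξ a b ≟ s)))
      (trans (cong (𝟙A a *_) (χ-×-dec (b ∈? A) (lin ξ a b ≟ s)))
             (sym (*-assoc (𝟙A a) (𝟙A b) (χ (lin ξ a b ≟ s)))))

  𝟙A²*χ≡1 : ∀ {ξ a b s} → a ∈ A → b ∈ A → lin ξ a b ≡ s → 𝟙A² a b * χ (lin ξ a b ≟ s) ≡ 1
  𝟙A²*χ≡1 {ξ} {a} {b} {s} a∈A b∈A lin≡s =
    cong₂ _*_ (cong₂ _*_ (χ-yes (a ∈? A) a∈A) (χ-yes (b ∈? A) b∈A)) (χ-yes (lin ξ a b ≟ s) lin≡s)

  collision⇒Deficient : ∀ {ξ a b a′ b′} → a ∈ A → b ∈ A → a′ ∈ A → b′ ∈ A →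
    ¬ (a ≡ a′ × b ≡ b′) → lin ξ a b ≡ lin ξ a′ b′ → Deficient ξ
  collision⇒Deficient {ξ} {a} {b} {a′} {b′} a∈A b∈A a′∈A b′∈A distinct collide = begin-strict
    ∣ S ξ A ∣                  ≡⟨ ∣S∣≡∑rep⊓1 ξ ⟩
    ∑[ s < q ] (rep ξ s ⊓ 1)   <⟨ sum-mono-< (λ s → m⊓n≤m (rep ξ s) 1) s rep⊓1<rep ⟩
    ∑[ s < q ] rep ξ s         ≡⟨ ∑rep≡∣A∣^2 ξ ⟩
    ∣ A ∣ ^ 2                  ∎
    where
    open ≤-Reasoning
    s : Fin q
    s = lin ξ a b
    2≤rep : 2 ≤ rep ξ s
    2≤rep = subst (_≤ rep ξ s) (cong₂ _+_ (𝟙A²*χ≡1 a∈A b∈A refl) (𝟙A²*χ≡1 a′∈A b′∈A (sym collide)))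
      (two-terms≤∑² (λ a b → 𝟙A² a b * χ (lin ξ a b ≟ s)) distinct)
    rep⊓1<rep : rep ξ s ⊓ 1 < rep ξ s
    rep⊓1<rep = <-≤-trans (s≤s (m⊓n≤n (rep ξ s) 1)) 2≤rep

  ¬Deficient⇒injective : ∀ {ξ a b a′ b′} → ¬ Deficient ξ → a ∈ A → b ∈ A → a′ ∈ A → b′ ∈ A →
    lin ξ a b ≡ lin ξ a′ b′ → a ≡ a′ × b ≡ b′
  ¬Deficient⇒injective {a = a} {b} {a′} {b′} ¬deficient a∈A b∈A a′∈A b′∈A collide
    with (a ≟ a′) ×-dec (b ≟ b′)
  ... | yes same    = same
  ... | no distinct = ⊥-elim (¬deficient (collision⇒Deficient a∈A b∈A a′∈A b′∈A distinct collide))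

  ratioCount≡∑ : ∀ h → ratioCount A h ≡ ∑[ d < q ] (𝟙A d * 𝟙A (h ·F d))
  ratioCount≡∑ h = begin
    ratioCount A h
      ≡⟨ length-filter-cartesianProduct {m = q} (λ (c , d) → ratio? c d) id ⟩
    ∑[ c < q ] ∑[ d < q ] χ (ratio? c d)
      ≡⟨ ∑-comm (λ c d → χ (ratio? c d)) ⟩
    ∑[ d < q ] ∑[ c < q ] χ (ratio? c d)
      ≡⟨ sum-cong-≗ (λ d → trans (sum-cong-≗ (χ-ratio d)) (sum-δ (λ c → 𝟙A d * 𝟙A c) (h ·F d))) ⟩
    ∑[ d < q ] (𝟙A d * 𝟙A (h ·F d))
      ∎
    where
    open ≡-Reasoning
    ratio? : ∀ c d → Dec (c ∈ A × d ∈ A × h ·F d ≡ c)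
    ratio? c d = (c ∈? A) ×-dec ((d ∈? A) ×-dec ((h ·F d) ≟ c))
    χ-ratio : ∀ d c → χ (ratio? c d) ≡ 𝟙A d * 𝟙A c * χ ((h ·F d) ≟ c)
    χ-ratio d c = begin
      χ (ratio? c d)                           ≡⟨ χ-×-dec (c ∈? A) ((d ∈? A) ×-dec ((h ·F d) ≟ c)) ⟩
      𝟙A c * χ ((d ∈? A) ×-dec ((h ·F d) ≟ c)) ≡⟨ cong (𝟙A c *_) (χ-×-dec (d ∈? A) ((h ·F d) ≟ c)) ⟩
      𝟙A c * (𝟙A d * χ ((h ·F d) ≟ c))        ≡⟨ x∙yz≈yx∙z (𝟙A c) (𝟙A d) (χ ((h ·F d) ≟ c)) ⟩
      𝟙A d * 𝟙A c * χ ((h ·F d) ≟ c)          ∎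

  ratio-triple? : ∀ h a d → Dec (a ∈ A × d ∈ A × h ·F d ∈ A)
  ratio-triple? h a d = (a ∈? A) ×-dec ((d ∈? A) ×-dec ((h ·F d) ∈? A))

  ∣A∣*ratioCount≡∑χ : ∀ h → ∣ A ∣ * ratioCount A h ≡ ∑[ a < q ] ∑[ d < q ] χ (ratio-triple? h a d)
  ∣A∣*ratioCount≡∑χ h = begin
    ∣ A ∣ * ratioCount A h
      ≡⟨ cong₂ _*_ (∣p∣≡∑χ A) (ratioCount≡∑ h) ⟩
    sum 𝟙A * r
      ≡⟨ *-distribʳ-sum r 𝟙A ⟩
    ∑[ a < q ] (𝟙A a * r)
      ≡⟨ sum-cong-≗ (λ a → *-distribˡ-sum (𝟙A a) (λ d → 𝟙A d * 𝟙A (h ·F d))) ⟩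
    ∑[ a < q ] ∑[ d < q ] (𝟙A a * (𝟙A d * 𝟙A (h ·F d)))
      ≡⟨ sum-cong-≗ (λ a → sum-cong-≗ λ d → χ-triple a d) ⟨
    ∑[ a < q ] ∑[ d < q ] χ (ratio-triple? h a d)
      ∎
    where
    open ≡-Reasoning
    r : ℕ
    r = ∑[ d < q ] (𝟙A d * 𝟙A (h ·F d))
    χ-triple : ∀ a d → χ (ratio-triple? h a d) ≡ 𝟙A a * (𝟙A d * 𝟙A (h ·F d))
    χ-triple a d = trans (χ-×-dec (a ∈? A) ((d ∈? A) ×-dec ((h ·F d) ∈? A)))
                         (cong (𝟙A a *_) (χ-×-dec (d ∈? A) ((h ·F d) ∈? A)))

  Deficient-oneF : 1 < ∣ A ∣ → Deficient oneF
  Deficient-oneF 1<∣A∣ =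
    let a , b , a∈A , b∈A , a≢b = two-elements A 1<∣A∣
    in collision⇒Deficient a∈A b∈A b∈A a∈A (λ (a≡b , _) → a≢b a≡b) (begin
      a +F (b ·F oneF)    ≡⟨ cong (a +F_) (·F-identityʳ b) ⟩
      a +F b              ≡⟨ +F-comm a b ⟩
      b +F a              ≡⟨ cong (b +F_) (·F-identityʳ a) ⟨
      b +F (a ·F oneF)    ∎)
    where open ≡-Reasoning

  lin-·F : ∀ ξ h a d → lin (ξ ·F h) a d ≡ lin ξ a (h ·F d)
  lin-·F ξ h a d = cong (a +F_) (·F-rotate d ξ h)

  ¬Deficient[ξh]⇒∣A∣*ratioCount≤∣Sξ∣ : ∀ {ξ h} → ¬ Deficient (ξ ·F h) →
    ∣ A ∣ * ratioCount A h ≤ ∣ S ξ A ∣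
  ¬Deficient[ξh]⇒∣A∣*ratioCount≤∣Sξ∣ {ξ} {h} ¬deficient =
    subst (_≤ ∣ S ξ A ∣) (sym (∣A∣*ratioCount≡∑χ h))
    (injection-bound (ratio-triple? h) (λ a d → lin ξ a (h ·F d)) (S ξ A)
      (λ (a∈A , _ , hd∈A) → lin∈S a∈A hd∈A)
      λ {a} {d} {a′} {d′} (a∈A , d∈A , _) (a′∈A , d′∈A , _) collide →
        ¬Deficient⇒injective ¬deficient a∈A d∈A a′∈A d′∈A
          (trans (lin-·F ξ h a d) (trans collide (sym (lin-·F ξ h a′ d′)))))

  InH⇒∣A∣^3≤5∣AA∣∣Sξ∣ : ∀ {ξ h} → InH A h → ∣ A ∣ * ratioCount A h ≤ ∣ S ξ A ∣ →
    ∣ A ∣ ^ 3 ≤ 5 * ∣ prodSet A ∣ * ∣ S ξ A ∣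
  InH⇒∣A∣^3≤5∣AA∣∣Sξ∣ {ξ} {h} inH ∣A∣r≤∣S∣ = begin
    ∣ A ∣ ^ 3                             ≡⟨ cube ∣ A ∣ ⟩
    ∣ A ∣ * (∣ A ∣ * ∣ A ∣)                ≤⟨ *-monoʳ-≤ ∣ A ∣ inH ⟩
    ∣ A ∣ * (5 * P * ratioCount A h)      ≡⟨ x∙yz≈y∙xz ∣ A ∣ (5 * P) (ratioCount A h) ⟩
    5 * P * (∣ A ∣ * ratioCount A h)      ≤⟨ *-monoʳ-≤ (5 * P) ∣A∣r≤∣S∣ ⟩
    5 * P * ∣ S ξ A ∣                     ∎
    where
    open ≤-Reasoning
    P : ℕ
    P = ∣ prodSet A ∣
    cube : ∀ n → n ^ 3 ≡ n * (n * n)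
    cube n = cong (λ t → n * (n * t)) (*-identityʳ n)

  Gen-invariant : (P : Fin q → Set) → (∀ {x h} → Gen A x → toℕ h ≢ 0 → InH A h → P x ⇔ P (x ·F h)) →
    ∀ {x z} → Gen A x → Gen A z → P z ⇔ P (z ·F x)
  Gen-invariant P step (gen-base h≢0 inH) gz = step gz h≢0 inH
  Gen-invariant P step {z = z} gen-one gz = subst (λ t → P z ⇔ P t) (sym (·F-identityʳ z)) ⇔-refl
  Gen-invariant P step {z = z} (gen-mul {x} {y} gx gy) gz = subst (λ t → P z ⇔ P t) (·F-assoc z x y)
    (⇔-trans (Gen-invariant P step gx gz) (Gen-invariant P step gy (gen-mul gz gx)))
  Gen-invariant P step {z = z} (gen-inv {x} {y} gx xy≡1) gz = subst (λ t → P t ⇔ P (z ·F y)) zyx≡z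
    (⇔-sym (Gen-invariant P step gx (gen-mul gz (gen-inv gx xy≡1))))
    where
    zyx≡z : (z ·F y) ·F x ≡ z
    zyx≡z = begin
      (z ·F y) ·F x   ≡⟨ ·F-assoc z y x ⟩
      z ·F (y ·F x)   ≡⟨ cong (z ·F_) (trans (·F-comm y x) xy≡1) ⟩
      z ·F oneF       ≡⟨ ·F-identityʳ z ⟩
      z               ∎
      where open ≡-Reasoning

  Gen-invariant-from-oneF : (P : Fin q → Set) → (∀ {x h} → Gen A x → toℕ h ≢ 0 → InH A h → P x ⇔ P (x ·F h)) →
    P oneF → ∀ {ξ} → Gen A ξ → P ξ
  Gen-invariant-from-oneF P step P1 {ξ} gξ =
    subst P (·F-identityˡ ξ) (Equivalence.to (Gen-invariant P step gξ gen-one) P1)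

  Boundary : Subset q → Fin q → Fin q → Set
  Boundary G x h = x ∈ G × toℕ h ≢ 0 × InH A h ×
    (Deficient x × ¬ Deficient (x ·F h) ⊎ ¬ Deficient x × Deficient (x ·F h))

  boundary? : ∀ G → Dec (∃ λ x → ∃ λ h → Boundary G x h)
  boundary? G = any? λ x → any? λ h →
    (x ∈? G) ×-dec ¬? (toℕ h ℕ.≟ 0) ×-dec (∣ A ∣ * ∣ A ∣ ≤? 5 * ∣ prodSet A ∣ * ratioCount A h)
    ×-dec (Deficient? x ×-dec ¬? (Deficient? (x ·F h)) ⊎-dec ¬? (Deficient? x) ×-dec Deficient? (x ·F h))

  ¬Boundary⇒Deficient : 1 < ∣ A ∣ → ∀ {G} → (∀ x → x ∈ G ⇔ Gen A x) →
    ¬ (∃ λ x → ∃ λ h → Boundary G x h) → ∀ {ξ} → Gen A ξ → Deficient ξ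
  ¬Boundary⇒Deficient 1<∣A∣ {G} G⇔Gen ¬boundary = Gen-invariant-from-oneF Deficient invariant (Deficient-oneF 1<∣A∣)
    where
    invariant : ∀ {x h} → Gen A x → toℕ h ≢ 0 → InH A h → Deficient x ⇔ Deficient (x ·F h)
    invariant {x} {h} gx h≢0 inH = mk⇔
      (λ def → decidable-stable (Deficient? (x ·F h)) λ ¬def → ¬boundary (x , h , x∈G , h≢0 , inH , inj₁ (def , ¬def)))
      (λ def → decidable-stable (Deficient? x) λ ¬def → ¬boundary (x , h , x∈G , h≢0 , inH , inj₂ (¬def , def)))
      where
      x∈G : x ∈ G
      x∈G = Equivalence.from (G⇔Gen x) gx

  energy : Fin q → ℕ
  energy ξ = ∑[ s < q ] (rep ξ s * rep ξ s)

  energy≡∑rep : ∀ ξ → energy ξ ≡ ∑[ a < q ] ∑[ b < q ] (𝟙A² a b * rep ξ (lin ξ a b))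
  energy≡∑rep ξ = trans (∑²-comm-weighted (rep ξ) 𝟙A² (λ a b s → χ (lin ξ a b ≟ s)))
    (sum-cong-≗ λ a → sum-cong-≗ λ b → cong (𝟙A² a b *_) (sum-δ (rep ξ) (lin ξ a b)))

  ∣A∣^4≤∣S∣*energy : ∀ ξ → ∣ A ∣ ^ 2 * ∣ A ∣ ^ 2 ≤ ∣ S ξ A ∣ * energy ξ
  ∣A∣^4≤∣S∣*energy ξ =
    subst₂ _≤_ (cong (λ t → t * t) (∑rep≡∣A∣^2 ξ)) (cong (_* energy ξ) (sym (∣S∣≡∑rep⊓1 ξ)))
      (cauchy-schwarz (rep ξ))

  module _ (prime : Prime q) where

    ¬Deficient[η]⇒∣A∣*ratioCount≤∣S[ηh]∣ : ∀ {η h} → toℕ h ≢ 0 → ¬ Deficient η →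
      ∣ A ∣ * ratioCount A h ≤ ∣ S (η ·F h) A ∣
    ¬Deficient[η]⇒∣A∣*ratioCount≤∣S[ηh]∣ {η} {h} h≢0 ¬deficient =
      subst (_≤ ∣ S (η ·F h) A ∣) (sym (∣A∣*ratioCount≡∑χ h))
      (injection-bound (ratio-triple? h) (lin (η ·F h)) (S (η ·F h) A)
        (λ (a∈A , d∈A , _) → lin∈S a∈A d∈A)
        λ {a} {d} {a′} {d′} (a∈A , _ , hd∈A) (a′∈A , _ , hd′∈A) collide →
          let a≡a′ , hd≡hd′ = ¬Deficient⇒injective ¬deficient a∈A hd∈A a′∈A hd′∈A
                                 (trans (sym (lin-·F η h a d)) (trans collide (lin-·F η h a′ d′)))
          in a≡a′ , ·F-cancelˡ prime h≢0 hd≡hd′)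

    module _ (G : Subset q) where

      𝟙G : Fin q → ℕ
      𝟙G ξ = χ (ξ ∈? G)

      collisions : Fin q → Fin q → Fin q → Fin q → ℕ
      collisions a b a′ b′ = ∑[ ξ < q ] (𝟙G ξ * χ (lin ξ a′ b′ ≟ lin ξ a b))

      collisions≤∣G∣ : ∀ a b a′ b′ → collisions a b a′ b′ ≤ ∣ G ∣
      collisions≤∣G∣ a b a′ b′ = subst (collisions a b a′ b′ ≤_) (sym (∣p∣≡∑χ G))
        (sum-mono-≤ λ ξ → ≤-trans (*-monoʳ-≤ (𝟙G ξ) (χ≤1 (lin ξ a′ b′ ≟ lin ξ a b)))
                                  (≤-reflexive (*-identityʳ (𝟙G ξ))))

      collisions≤1 : ∀ {a b a′ b′} → ¬ (a′ ≡ a × b′ ≡ b) → collisions a b a′ b′ ≤ 1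
      collisions≤1 {a} {b} {a′} {b′} distinct = sum≤1 _
        (λ ξ → *-mono-≤ (χ≤1 (ξ ∈? G)) (χ≤1 (lin ξ a′ b′ ≟ lin ξ a b)))
        λ ξ η p p′ → lines-meet-once prime distinct (proj₂ (0<χ*χ⇒ (ξ ∈? G) (lin ξ a′ b′ ≟ lin ξ a b) p))
                                                     (proj₂ (0<χ*χ⇒ (η ∈? G) (lin η a′ b′ ≟ lin η a b) p′))

      collisions≤ : ∀ a b a′ b′ → collisions a b a′ b′ ≤ χ (a ≟ a′) * (χ (b ≟ b′) * ∣ G ∣) + 1
      collisions≤ a b a′ b′ with a ≟ a′ | b ≟ b′
      ... | yes refl | yes refl = begin
        collisions a b a b    ≤⟨ collisions≤∣G∣ a b a b ⟩
        ∣ G ∣                 ≡⟨ trans (*-identityˡ (1 * ∣ G ∣)) (*-identityˡ ∣ G ∣) ⟨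
        1 * (1 * ∣ G ∣)       ≤⟨ m≤m+n (1 * (1 * ∣ G ∣)) 1 ⟩
        1 * (1 * ∣ G ∣) + 1   ∎
        where open ≤-Reasoning
      ... | yes refl | no b≢b′  = ≤-trans (collisions≤1 {a} {b} {a} {b′} (b≢b′ ∘ sym ∘ proj₂)) (m≤n+m 1 0)
      ... | no a≢a′  | _        = ≤-trans (collisions≤1 {a} {b} {a′} {b′} (a≢a′ ∘ sym ∘ proj₁)) (m≤n+m 1 0)

      ∑G-rep≤ : ∀ a b → ∑[ ξ < q ] (𝟙G ξ * rep ξ (lin ξ a b)) ≤ ∣ G ∣ + ∣ A ∣ ^ 2
      ∑G-rep≤ a b = begin
        ∑[ ξ < q ] (𝟙G ξ * rep ξ (lin ξ a b))
          ≡⟨ ∑²-comm-weighted 𝟙G 𝟙A² (λ a′ b′ ξ → χ (lin ξ a′ b′ ≟ lin ξ a b)) ⟩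
        ∑[ a′ < q ] ∑[ b′ < q ] (𝟙A² a′ b′ * collisions a b a′ b′)
          ≤⟨ sum-mono-≤ (λ a′ → sum-mono-≤ λ b′ → *-monoʳ-≤ (𝟙A² a′ b′) (collisions≤ a b a′ b′)) ⟩
        ∑[ a′ < q ] ∑[ b′ < q ] (𝟙A² a′ b′ * (χ (a ≟ a′) * (χ (b ≟ b′) * ∣ G ∣) + 1))
          ≡⟨ ∑²-δ-+ 𝟙A² ∣ G ∣ a b ⟩
        𝟙A² a b * ∣ G ∣ + ∑[ a′ < q ] ∑[ b′ < q ] 𝟙A² a′ b′
          ≤⟨ +-mono-≤ (*-monoˡ-≤ ∣ G ∣ (*-mono-≤ (χ≤1 (a ∈? A)) (χ≤1 (b ∈? A)))) (≤-reflexive ∑𝟙A²≡∣A∣^2) ⟩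
        1 * ∣ G ∣ + ∣ A ∣ ^ 2
          ≡⟨ cong (_+ ∣ A ∣ ^ 2) (*-identityˡ ∣ G ∣) ⟩
        ∣ G ∣ + ∣ A ∣ ^ 2 ∎
        where open ≤-Reasoning

      ∑G-energy≤ : ∑[ ξ < q ] (𝟙G ξ * energy ξ) ≤ ∣ A ∣ ^ 2 * (∣ G ∣ + ∣ A ∣ ^ 2)
      ∑G-energy≤ = begin
        ∑[ ξ < q ] (𝟙G ξ * energy ξ)
          ≡⟨ sum-cong-≗ (λ ξ → cong (𝟙G ξ *_) (energy≡∑rep ξ)) ⟩
        ∑[ ξ < q ] (𝟙G ξ * ∑[ a < q ] ∑[ b < q ] (𝟙A² a b * rep ξ (lin ξ a b)))
          ≡⟨ ∑²-comm-weighted 𝟙G 𝟙A² (λ a b ξ → rep ξ (lin ξ a b)) ⟩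
        ∑[ a < q ] ∑[ b < q ] (𝟙A² a b * ∑[ ξ < q ] (𝟙G ξ * rep ξ (lin ξ a b)))
          ≤⟨ sum-mono-≤ (λ a → sum-mono-≤ λ b → *-monoʳ-≤ (𝟙A² a b) (∑G-rep≤ a b)) ⟩
        ∑[ a < q ] ∑[ b < q ] (𝟙A² a b * (∣ G ∣ + ∣ A ∣ ^ 2))
          ≡⟨ sum-cong-≗ (λ a → *-distribʳ-sum (∣ G ∣ + ∣ A ∣ ^ 2) (𝟙A² a)) ⟨
        ∑[ a < q ] (∑[ b < q ] 𝟙A² a b * (∣ G ∣ + ∣ A ∣ ^ 2))
          ≡⟨ *-distribʳ-sum (∣ G ∣ + ∣ A ∣ ^ 2) (sum ∘ 𝟙A²) ⟨
        ∑[ a < q ] ∑[ b < q ] 𝟙A² a b * (∣ G ∣ + ∣ A ∣ ^ 2)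
          ≡⟨ cong (_* (∣ G ∣ + ∣ A ∣ ^ 2)) ∑𝟙A²≡∣A∣^2 ⟩
        ∣ A ∣ ^ 2 * (∣ G ∣ + ∣ A ∣ ^ 2) ∎
        where open ≤-Reasoning

      large-sumset-in : 0 < ∣ A ∣ → 0 < ∣ G ∣ →
        ∃ λ ξ → ξ ∈ G × ∣ A ∣ ^ 2 * ∣ G ∣ ≤ ∣ S ξ A ∣ * (∣ A ∣ ^ 2 + ∣ G ∣)
      large-sumset-in 0<∣A∣ 0<∣G∣ with average-attained 𝟙G energy (subst (0 <_) (∣p∣≡∑χ G) 0<∣G∣)
      ... | ξ , 0<𝟙Gξ , below-average = ξ , 0<χ⇒ (ξ ∈? G) 0<𝟙Gξ ,
        N²≤se∧ge≤N[g+N]⇒Ng≤s[N+g] {s = ∣ S ξ A ∣} (m^n>0 ∣ A ∣ {{>-nonZero 0<∣A∣}} 2)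
          (∣A∣^4≤∣S∣*energy ξ) ∣G∣*energy≤
        where
        open ≤-Reasoning
        ∣G∣*energy≤ : ∣ G ∣ * energy ξ ≤ ∣ A ∣ ^ 2 * (∣ G ∣ + ∣ A ∣ ^ 2)
        ∣G∣*energy≤ = begin
          ∣ G ∣ * energy ξ                   ≡⟨ cong (_* energy ξ) (∣p∣≡∑χ G) ⟩
          sum 𝟙G * energy ξ                  ≤⟨ below-average ⟩
          ∑[ η < q ] (𝟙G η * energy η)       ≤⟨ ∑G-energy≤ ⟩
          ∣ A ∣ ^ 2 * (∣ G ∣ + ∣ A ∣ ^ 2)    ∎

lemma4 : (q : ℕ) .{{_ : NonZero q}} → Prime q →
    (A : Subset q) → (∀ a → a ∈ A → ¬ (toℕ a ≡ 0)) → 1 < ∣ A ∣ →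
    (G : Subset q) → (∀ x → (x ∈ G) ⇔ Gen A x) →
    ∃[ ξ ] (ξ ∈ G
      × ((∣ A ∣ ^ 3 ≤ 5 * ∣ prodSet A ∣ * ∣ S ξ A ∣)
         ⊎ (∣ A ∣ ^ 2 * ∣ G ∣ ≤ ∣ S ξ A ∣ * (∣ A ∣ ^ 2 + ∣ G ∣)))
      × ∣ S ξ A ∣ < ∣ A ∣ ^ 2)
lemma4 q q-prime A _ 1<∣A∣ G G⇔Gen with Sumsets.boundary? q A G
... | yes (x , h , x∈G , _ , inH , inj₁ (deficient , ¬deficient)) =
  x , x∈G , inj₁ (InH⇒∣A∣^3≤5∣AA∣∣Sξ∣ {h = h} inH (¬Deficient[ξh]⇒∣A∣*ratioCount≤∣Sξ∣ ¬deficient)) ,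
  deficient
  where open Sumsets q A
... | yes (x , h , x∈G , h≢0 , inH , inj₂ (¬deficient , deficient)) =
  x ·F h , xh∈G ,
  inj₁ (InH⇒∣A∣^3≤5∣AA∣∣Sξ∣ {h = h} inH (¬Deficient[η]⇒∣A∣*ratioCount≤∣S[ηh]∣ q-prime h≢0 ¬deficient)) ,
  deficient
  where
  open Sumsets q A
  xh∈G : x ·F h ∈ G
  xh∈G = Equivalence.from (G⇔Gen (x ·F h)) (gen-mul (Equivalence.to (G⇔Gen x) x∈G) (gen-base h≢0 inH))
... | no ¬boundary =
  let ξ , ξ∈G , large = large-sumset-in q-prime G (<-trans z<s 1<∣A∣) (x∈p⇒0<∣p∣ oneF∈G)
  in ξ , ξ∈G , inj₂ large , ¬Boundary⇒Deficient 1<∣A∣ G⇔Gen ¬boundary (Equivalence.to (G⇔Gen ξ) ξ∈G)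
  where
  open Sumsets q A
  oneF∈G : oneF ∈ G
  oneF∈G = Equivalence.from (G⇔Gen oneF) gen-one
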